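{- Let $\Gamma$ be a connected weighted graph with $n$ vertices and weighted Laplacian $L$. Then $\mathrm{rank}(L) = n-1$.
   Context: A weighted graph $\Gamma$ is a finite connected multigraph without loops, with vertex set $V(\Gamma)$, edge set $E(\Gamma)$, and weights $w: V(\Gamma)\cup E(\Gamma)\to\mathbb{Z}_{>0}$ such that the weight of each edge divides the weights of both of its endpoints. $E(v)$ denotes the set of edges incident to $v$ and $E(u,v)$ the set of edges joining $u$ and $v$. The weighted valency is $\mathrm{val}(v)=\sum_{e\in E(v)} w(v)/w(e)$. With vertices $v_1,\dots,v_n$, the weighted Laplacian is the $n\times n$ integer matrix $L$ with $L_{ii}=\mathrm{val}(v_i)$ and $L_{ij} = -\sum_{e\in E(v_i,v_j)} w(v_j)/w(e)$ for $i\neq j$. -}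

module Defs where

open import Data.Nat as ℕ using (ℕ; zero; suc; _<_; _>_; >-nonZero)
open import Data.Nat.DivMod using (_/_)
open import Data.Nat.Divisibility using (_∣_)
open import Data.Integer as ℤ using (ℤ; +_; -_)
open import Data.Rational as ℚ using (ℚ; 0ℚ)
open import Data.Fin using (Fin; zero; suc; _≟_)
open import Data.Bool using (Bool; true; false; if_then_else_; _∧_; _∨_)
open import Data.Product using (Σ; _×_; _,_; ∃)
open import Data.Sum using (_⊎_)
open import Relation.Nullary using (¬_; does)
open import Relation.Binary.PropositionalEquality using (_≡_; _≢_)
open import Function.Definitions using (Injective)

-- Weighted (multi)graphs without loops on the vertex set Fin n.
-- Edges are indexed by Fin m; each edge e joins src e and tgt e
-- (the orientation is an arbitrary labelling, irrelevant below).

record WGraph (n : ℕ) : Set where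
  field
    m       : ℕ
    src tgt : Fin m → Fin n
    noLoop  : ∀ e → src e ≢ tgt e
    vw      : Fin n → ℕ
    ew      : Fin m → ℕ
    vw-pos  : ∀ v → vw v > 0
    ew-pos  : ∀ e → ew e > 0
    ew∣src  : ∀ e → ew e ∣ vw (src e)
    ew∣tgt  : ∀ e → ew e ∣ vw (tgt e)

open WGraph public

Joins : ∀ {n} (Γ : WGraph n) → Fin (m Γ) → Fin n → Fin n → Set
Joins Γ e u v = (src Γ e ≡ u × tgt Γ e ≡ v) ⊎ (src Γ e ≡ v × tgt Γ e ≡ u)

data Reach {n} (Γ : WGraph n) : Fin n → Fin n → Set where
  here : ∀ {u} → Reach Γ u u
  step : ∀ {u v w} (e : Fin (m Γ)) → Joins Γ e u v → Reach Γ v w → Reach Γ u w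

Connected : ∀ {n} → WGraph n → Set
Connected {n} Γ = ∀ (u v : Fin n) → Reach Γ u v

∑ℕ : ∀ {k} → (Fin k → ℕ) → ℕ
∑ℕ {zero}  f = 0
∑ℕ {suc k} f = f zero ℕ.+ ∑ℕ (λ i → f (suc i))

∑ℚ : ∀ {k} → (Fin k → ℚ) → ℚ
∑ℚ {zero}  f = 0ℚ
∑ℚ {suc k} f = f zero ℚ.+ ∑ℚ (λ i → f (suc i))

-- x / w(e)  (exact when w(e) ∣ x, as is the case below)
divEW : ∀ {n} (Γ : WGraph n) → Fin (m Γ) → ℕ → ℕ
divEW Γ e x = _/_ x (ew Γ e) {{>-nonZero (ew-pos Γ e)}}

incidentᵇ : ∀ {n} (Γ : WGraph n) → Fin (m Γ) → Fin n → Bool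
incidentᵇ Γ e v = does (src Γ e ≟ v) ∨ does (tgt Γ e ≟ v)

joinsᵇ : ∀ {n} (Γ : WGraph n) → Fin (m Γ) → Fin n → Fin n → Bool
joinsᵇ Γ e u v = (does (src Γ e ≟ u) ∧ does (tgt Γ e ≟ v))
               ∨ (does (src Γ e ≟ v) ∧ does (tgt Γ e ≟ u))

val : ∀ {n} (Γ : WGraph n) → Fin n → ℕ
val Γ v = ∑ℕ (λ e → if incidentᵇ Γ e v then divEW Γ e (vw Γ v) else 0)

laplacian : ∀ {n} (Γ : WGraph n) → Fin n → Fin n → ℤ
laplacian Γ i j with does (i ≟ j)
... | true  = + val Γ i
... | false = - (+ ∑ℕ (λ e → if joinsᵇ Γ e i j then divEW Γ e (vw Γ j) else 0))

Matrix : ℕ → ℕ → Set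
Matrix r c = Fin r → Fin c → ℤ

toℚ : ℤ → ℚ
toℚ z = z ℚ./ 1

ColumnsIndependent : ∀ {r c k} → Matrix r c → (Fin k → Fin c) → Set
ColumnsIndependent {r} {c} {k} M sel =
  ∀ (a : Fin k → ℚ) →
    (∀ (i : Fin r) → ∑ℚ (λ t → a t ℚ.* toℚ (M i (sel t))) ≡ 0ℚ) →
    ∀ t → a t ≡ 0ℚ

HasIndepColumns : ∀ {r c} → Matrix r c → ℕ → Set
HasIndepColumns {r} {c} M k =
  Σ (Fin k → Fin c) λ sel → Injective _≡_ _≡_ sel × ColumnsIndependent M sel

HasRank : ∀ {r c} → Matrix r c → ℕ → Set
HasRank M k = HasIndepColumns M k × (∀ k′ → k < k′ → ¬ HasIndepColumns M k′)

-- Put y_j = w(v_j) a_j. Because w(e) divides the weights of both ends of e, the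
-- relation ∑_j a_j L_ij = 0 becomes ∑_{e ∋ v_i} (y_i − y_{other end of e}) / w(e) = 0:
-- y is harmonic for the positive conductances 1/w(e). By the maximum principle a
-- harmonic function on a connected graph is constant, so the column relations of L
-- are exactly the multiples of a_j = 1/w(v_j). That relation is nonzero, so the n
-- columns are dependent; and a relation not involving column 0 has a_0 = 0, hence is
-- trivial, so the remaining n − 1 columns are independent.

module Submission where

open import Defs
open import Algebra.Bundles using (CommutativeRing)
import Algebra.Properties.Group as GroupProperties
open import Data.Bool using (true; false; if_then_else_; _∨_)
open import Data.Bool.Properties using (if-float; ∧-zeroʳ; ∧-identityʳ; ∨-identityʳ)
open import Data.Empty using (⊥-elim)
open import Data.Fin using (Fin; zero; suc; _≟_; punchOut)
open import Data.Fin.Permutation using (Permutation; permutation)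
open import Data.Fin.Properties using (any?; injective⇒≤; punchOut-injective; suc-injective)
import Data.Integer as ℤ
import Data.Integer.Properties as ℤ
open import Data.List.Base using (allFin)
open import Data.List.Membership.Propositional.Properties using (∈-allFin)
import Data.List.Relation.Unary.Any as Any
open import Data.Nat as ℕ using (ℕ; zero; suc)
open import Data.Nat.DivMod using (m/n*n≡m)
open import Data.Nat.Divisibility using (_∣_)
import Data.Nat.Coprimality as Coprime
import Data.Nat.Properties as ℕ
open import Data.Product using (_,_; proj₁; proj₂; ∃)
open import Data.Rational as ℚ using (ℚ; 0ℚ; 1ℚ; _+_; _*_; -_; _-_; _≤_; 1/_; NonZero; Positive)
open import Data.Rational.Properties hiding (_≟_)
open import Data.Rational.Solver using (module +-*-Solver)
open import Data.Sum using (inj₁; inj₂)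
open import Data.Vec.Functional using (_∷_)
open import Function.Definitions using (Injective)
open import Relation.Binary.Bundles using (DecTotalOrder)
open import Relation.Binary.PropositionalEquality
open import Relation.Nullary using (¬_; does; yes; no)

open import Algebra.Properties.Semiring.Sum (CommutativeRing.semiring +-*-commutativeRing)
  using (sum; sum-syntax; sum-cong-≗; sum-replicate-zero; ∑-distrib-+; ∑-comm; sum-permute; *-distribˡ-sum)
open import Data.List.Extrema (DecTotalOrder.totalOrder ≤-decTotalOrder) using (argmax; v≤f[argmax]⁺)
open GroupProperties +-0-group using (x∙y⁻¹≈ε⇒x≈y)
open +-*-Solver using (solve; _:*_; _:-_; _:=_)
open ≡-Reasoning

p≤q⇒0≤q-p : ∀ {p q} → p ≤ q → 0ℚ ≤ q - p
p≤q⇒0≤q-p {p} p≤q = ≤-trans (≤-reflexive (sym (+-inverseʳ p))) (+-monoˡ-≤ (- p) p≤q)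

*-distribˡ-- : ∀ p q r → p * (q - r) ≡ p * q - p * r
*-distribˡ-- = solve 3 (λ p q r → p :* (q :- r) := p :* q :- p :* r) refl

p*q≡0⇒q≡0 : ∀ p .{{_ : NonZero p}} q → p * q ≡ 0ℚ → q ≡ 0ℚ
p*q≡0⇒q≡0 p q pq≡0 = begin
  q                ≡⟨ *-identityˡ q ⟨
  1ℚ * q           ≡⟨ cong (_* q) (*-inverseˡ p) ⟨
  1/ p * p * q     ≡⟨ *-assoc (1/ p) p q ⟩
  1/ p * (p * q)   ≡⟨ cong (1/ p *_) pq≡0 ⟩
  1/ p * 0ℚ        ≡⟨ *-zeroʳ (1/ p) ⟩
  0ℚ               ∎

fromℕ : ℕ → ℚ
fromℕ n = toℚ (ℤ.+ n)

fromℕ≡mkℚ : ∀ n → fromℕ n ≡ ℚ.mkℚ (ℤ.+ n) 0 (Coprime.sym (Coprime.1-coprimeTo n))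
fromℕ≡mkℚ n = ↥p/↧p≡p _

-- Once both summands are in normal form, ℚ._+_ and ℚ._*_ reduce to ℤ arithmetic.
fromℕ-+ : ∀ m n → fromℕ (m ℕ.+ n) ≡ fromℕ m + fromℕ n
fromℕ-+ m n rewrite fromℕ≡mkℚ m | fromℕ≡mkℚ n = cong (ℚ._/ 1) (begin
  ℤ.+ (m ℕ.+ n)                          ≡⟨ ℤ.pos-+ m n ⟩
  ℤ.+ m ℤ.+ ℤ.+ n                        ≡⟨ cong₂ ℤ._+_ (ℤ.*-identityʳ (ℤ.+ m)) (ℤ.*-identityʳ (ℤ.+ n)) ⟨
  ℤ.+ m ℤ.* ℤ.+ 1 ℤ.+ ℤ.+ n ℤ.* ℤ.+ 1    ∎)

fromℕ-* : ∀ m n → fromℕ (m ℕ.* n) ≡ fromℕ m * fromℕ n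
fromℕ-* m n rewrite fromℕ≡mkℚ m | fromℕ≡mkℚ n = cong (ℚ._/ 1) (ℤ.pos-* m n)

toℚ-neg : ∀ n → toℚ (ℤ.- ℤ.+ n) ≡ - fromℕ n
toℚ-neg zero    = refl
toℚ-neg (suc n) = refl

fromℕ-pos : ∀ {n} → n ℕ.> 0 → Positive (fromℕ n)
fromℕ-pos {suc n} _ = normalize-pos (suc n) 1

fromℕ-nonZero : ∀ {n} → n ℕ.> 0 → NonZero (fromℕ n)
fromℕ-nonZero {n} n>0 = pos⇒nonZero (fromℕ n) {{fromℕ-pos n>0}}

fromℕ-/ : ∀ {x d} (d>0 : d ℕ.> 0) → d ∣ x →
          fromℕ ((x ℕ./ d) {{ℕ.>-nonZero d>0}}) ≡ (1/ fromℕ d) {{fromℕ-nonZero d>0}} * fromℕ x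
fromℕ-/ {x} {d} d>0 d∣x = begin
  fromℕ (x ℕ./ d)                     ≡⟨ *-identityʳ _ ⟨
  fromℕ (x ℕ./ d) * 1ℚ                ≡⟨ cong (fromℕ (x ℕ./ d) *_) (*-inverseʳ (fromℕ d)) ⟨
  fromℕ (x ℕ./ d) * (fromℕ d * 1/d)   ≡⟨ *-assoc (fromℕ (x ℕ./ d)) (fromℕ d) 1/d ⟨
  fromℕ (x ℕ./ d) * fromℕ d * 1/d     ≡⟨ cong (_* 1/d) (fromℕ-* (x ℕ./ d) d) ⟨
  fromℕ (x ℕ./ d ℕ.* d) * 1/d         ≡⟨ cong (λ z → fromℕ z * 1/d) (m/n*n≡m d∣x) ⟩
  fromℕ x * 1/d                       ≡⟨ *-comm (fromℕ x) 1/d ⟩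
  1/d * fromℕ x                       ∎
  where
  instance
    _ = ℕ.>-nonZero d>0
    _ = fromℕ-nonZero d>0
  1/d : ℚ
  1/d = 1/ fromℕ d

∑ℚ≡sum : ∀ {k} (f : Fin k → ℚ) → ∑ℚ f ≡ sum f
∑ℚ≡sum {zero}  f = refl
∑ℚ≡sum {suc k} f = cong (f zero +_) (∑ℚ≡sum (λ i → f (suc i)))

fromℕ-∑ℕ : ∀ {k} (f : Fin k → ℕ) → fromℕ (∑ℕ f) ≡ ∑[ i < k ] fromℕ (f i)
fromℕ-∑ℕ {zero}  f = refl
fromℕ-∑ℕ {suc k} f = trans (fromℕ-+ (f zero) _) (cong (fromℕ (f zero) +_) (fromℕ-∑ℕ (λ i → f (suc i))))

sum-neg : ∀ {k} (f : Fin k → ℚ) → ∑[ i < k ] (- f i) ≡ - sum f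
sum-neg {zero}  f = refl
sum-neg {suc k} f = trans (cong (- f zero +_) (sum-neg (λ i → f (suc i))))
                          (sym (neg-distrib-+ (f zero) (∑[ i < k ] f (suc i))))

sum-distrib-- : ∀ {k} (f g : Fin k → ℚ) → ∑[ i < k ] (f i - g i) ≡ sum f - sum g
sum-distrib-- f g = trans (∑-distrib-+ f (λ i → - g i)) (cong (sum f +_) (sum-neg g))

*-if : ∀ p b q → p * (if b then q else 0ℚ) ≡ (if b then p * q else 0ℚ)
*-if p true  q = refl
*-if p false q = *-zeroʳ p

sum-δ : ∀ {k} (x : Fin k) (f : Fin k → ℚ) → ∑[ j < k ] (if does (x ≟ j) then f j else 0ℚ) ≡ f x
sum-δ {suc k} zero    f = trans (cong (f zero +_) (sum-replicate-zero k)) (+-identityʳ _)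
sum-δ {suc k} (suc x) f = trans (+-identityˡ _) (sum-δ x (λ j → f (suc j)))

sum-nonneg : ∀ {k} (f : Fin k → ℚ) → (∀ i → 0ℚ ≤ f i) → 0ℚ ≤ sum f
sum-nonneg {zero}  f f≥0 = ≤-refl
sum-nonneg {suc k} f f≥0 = +-mono-≤ (f≥0 zero) (sum-nonneg (λ i → f (suc i)) (λ i → f≥0 (suc i)))

nonneg-sum≡0⇒≡0 : ∀ {k} (f : Fin k → ℚ) → (∀ i → 0ℚ ≤ f i) → sum f ≡ 0ℚ → ∀ i → f i ≡ 0ℚ
nonneg-sum≡0⇒≡0 {suc k} f f≥0 ∑f≡0 = λ where
    zero    → f₀≡0
    (suc i) → nonneg-sum≡0⇒≡0 (λ i → f (suc i)) (λ i → f≥0 (suc i)) rest≡0 i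
  where
  rest = ∑[ i < k ] f (suc i)
  rest≥0 : 0ℚ ≤ rest
  rest≥0 = sum-nonneg (λ i → f (suc i)) (λ i → f≥0 (suc i))
  f₀≡0 : f zero ≡ 0ℚ
  f₀≡0 = ≤-antisym
    (≤-trans (≤-reflexive (sym (+-identityʳ (f zero))))
      (≤-trans (+-monoʳ-≤ (f zero) rest≥0) (≤-reflexive ∑f≡0)))
    (f≥0 zero)
  rest≡0 : rest ≡ 0ℚ
  rest≡0 = trans (sym (+-identityˡ rest)) (trans (cong (_+ rest) (sym f₀≡0)) ∑f≡0)

maximum-point : ∀ {k} (f : Fin (suc k) → ℚ) → ∃ λ M → ∀ j → f j ≤ f M
maximum-point {k} f = M , λ j → v≤f[argmax]⁺ {f = f} zero (allFin (suc k)) (inj₂ (f≤f[j] j))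
  where
  M : Fin (suc k)
  M = argmax f zero (allFin (suc k))
  f≤f[j] : ∀ j → Any.Any (λ i → f j ≤ f i) (allFin (suc k))
  f≤f[j] j = Any.map (λ { refl → ≤-refl }) (∈-allFin j)

injective⇒surjective : ∀ {k} {σ : Fin k → Fin k} → Injective _≡_ _≡_ σ → ∀ j → ∃ λ t → σ t ≡ j
injective⇒surjective {suc k} {σ} σ-inj j with any? (λ t → σ t ≟ j)
... | yes hit = hit
... | no  miss = ⊥-elim (ℕ.1+n≰n (injective⇒≤ σ′-inj))
  where
  σ′ : Fin (suc k) → Fin k
  σ′ t = punchOut {i = j} {j = σ t} (λ eq → miss (t , sym eq))
  σ′-inj : Injective _≡_ _≡_ σ′
  σ′-inj {t₁} {t₂} eq = σ-inj (punchOut-injective (λ eq → miss (t₁ , sym eq)) (λ eq → miss (t₂ , sym eq)) eq)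

sum-reindex : ∀ {k} {σ : Fin k → Fin k} → Injective _≡_ _≡_ σ → (f : Fin k → ℚ) →
              ∑[ t < k ] f (σ t) ≡ sum f
sum-reindex {k} {σ} σ-inj f = sym (sum-permute f π)
  where
  σ⁻¹ : Fin k → Fin k
  σ⁻¹ j = proj₁ (injective⇒surjective σ-inj j)
  π : Permutation k k
  π = permutation σ σ⁻¹ (λ j → proj₂ (injective⇒surjective σ-inj j))
                        (λ t → σ-inj (proj₂ (injective⇒surjective σ-inj (σ t))))

module _ {n} (Γ : WGraph n) where

  opposite : Fin (m Γ) → Fin n → Fin n
  opposite e i = if does (src Γ e ≟ i) then tgt Γ e else src Γ e

  joinsᵇ-diag : ∀ e i → joinsᵇ Γ e i i ≡ false
  joinsᵇ-diag e i with src Γ e ≟ i | tgt Γ e ≟ i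
  ... | yes s≡i | yes t≡i = ⊥-elim (noLoop Γ e (trans s≡i (sym t≡i)))
  ... | yes _   | no _    = refl
  ... | no _    | yes _   = refl
  ... | no _    | no _    = refl

  sum-joinsᵇ : ∀ e i (g : Fin n → ℚ) →
               ∑[ j < n ] (if joinsᵇ Γ e i j then g j else 0ℚ)
               ≡ (if incidentᵇ Γ e i then g (opposite e i) else 0ℚ)
  sum-joinsᵇ e i g with src Γ e ≟ i | tgt Γ e ≟ i
  ... | yes s≡i | yes t≡i = ⊥-elim (noLoop Γ e (trans s≡i (sym t≡i)))
  ... | yes _ | no _ = trans (sum-cong-≗ λ j → cong (λ b → if b then g j else 0ℚ)
                         (trans (cong (does (tgt Γ e ≟ j) ∨_) (∧-zeroʳ _)) (∨-identityʳ _)))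
                       (sum-δ (tgt Γ e) g)
  ... | no _ | yes _ = trans (sum-cong-≗ λ j → cong (λ b → if b then g j else 0ℚ) (∧-identityʳ _))
                       (sum-δ (src Γ e) g)
  ... | no _ | no _  = trans (sum-cong-≗ λ j → cong (λ b → if b then g j else 0ℚ) (∧-zeroʳ _))
                       (sum-replicate-zero n)

  Joins⇒incidentᵇ : ∀ {e u v} → Joins Γ e u v → incidentᵇ Γ e u ≡ true
  Joins⇒incidentᵇ {e} {u} (inj₁ (refl , _)) with src Γ e ≟ src Γ e
  ... | yes _  = refl
  ... | no s≢s = ⊥-elim (s≢s refl)
  Joins⇒incidentᵇ {e} {u} (inj₂ (_ , refl)) with src Γ e ≟ tgt Γ e | tgt Γ e ≟ tgt Γ e
  ... | yes _ | _       = refl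
  ... | no _  | yes _   = refl
  ... | no _  | no t≢t  = ⊥-elim (t≢t refl)

  Joins⇒opposite : ∀ {e u v} → Joins Γ e u v → opposite e u ≡ v
  Joins⇒opposite {e} (inj₁ (refl , refl)) with src Γ e ≟ src Γ e
  ... | yes _  = refl
  ... | no s≢s = ⊥-elim (s≢s refl)
  Joins⇒opposite {e} (inj₂ (refl , refl)) with src Γ e ≟ tgt Γ e
  ... | yes s≡t = ⊥-elim (noLoop Γ e s≡t)
  ... | no _    = refl

  ew∣incident : ∀ e i → incidentᵇ Γ e i ≡ true → ew Γ e ∣ vw Γ i
  ew∣incident e i inc with src Γ e ≟ i | tgt Γ e ≟ i
  ... | yes refl | _        = ew∣src Γ e
  ... | no _     | yes refl = ew∣tgt Γ e

  ew∣opposite : ∀ e i → ew Γ e ∣ vw Γ (opposite e i)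
  ew∣opposite e i with does (src Γ e ≟ i)
  ... | true  = ew∣tgt Γ e
  ... | false = ew∣src Γ e

-- Harmonic functions and the maximum principle

module _ {n} (Γ : WGraph n) (κ : Fin (m Γ) → ℚ) where

  flux : (Fin n → ℚ) → Fin n → Fin (m Γ) → ℚ
  flux y i e = if incidentᵇ Γ e i then κ e * (y i - y (opposite Γ e i)) else 0ℚ

  outflow : (Fin n → ℚ) → Fin n → ℚ
  outflow y i = sum (flux y i)

  Harmonic : (Fin n → ℚ) → Set
  Harmonic y = ∀ i → outflow y i ≡ 0ℚ

  flux-incident : ∀ y {i e} → incidentᵇ Γ e i ≡ true → flux y i e ≡ κ e * (y i - y (opposite Γ e i))
  flux-incident y {i} {e} inc = cong (λ b → if b then κ e * (y i - y (opposite Γ e i)) else 0ℚ) inc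

  constant⇒harmonic : ∀ y c → (∀ j → y j ≡ c) → Harmonic y
  constant⇒harmonic y c y≡c i = trans (sum-cong-≗ flux≡0) (sum-replicate-zero (m Γ))
    where
    flux≡0 : ∀ e → flux y i e ≡ 0ℚ
    flux≡0 e with incidentᵇ Γ e i
    ... | true  = begin
      κ e * (y i - y (opposite Γ e i))  ≡⟨ cong₂ (λ p q → κ e * (p - q)) (y≡c i) (y≡c (opposite Γ e i)) ⟩
      κ e * (c - c)                     ≡⟨ cong (κ e *_) (+-inverseʳ c) ⟩
      κ e * 0ℚ                          ≡⟨ *-zeroʳ (κ e) ⟩
      0ℚ                                ∎
    ... | false = refl

  module _ (κ>0 : ∀ e → Positive (κ e)) where

    flux-nonneg-at-max : ∀ y {u} → (∀ j → y j ≤ y u) → ∀ e → 0ℚ ≤ flux y u e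
    flux-nonneg-at-max y {u} y≤yᵤ e with incidentᵇ Γ e u
    ... | true  = ≤-trans (≤-reflexive (sym (*-zeroʳ (κ e))))
                    (*-monoˡ-≤-nonNeg (κ e) {{pos⇒nonNeg (κ e) {{κ>0 e}}}} (p≤q⇒0≤q-p (y≤yᵤ (opposite Γ e u))))
    ... | false = ≤-refl

    module _ {y : Fin n → ℚ} (harmonic : Harmonic y) where

      -- At a maximum every flux is nonnegative and they sum to 0, so all of them vanish.
      max-spreads-along-edge : ∀ {e u v} → (∀ j → y j ≤ y u) → Joins Γ e u v → y v ≡ y u
      max-spreads-along-edge {e} {u} {v} y≤yᵤ uv =
        sym (x∙y⁻¹≈ε⇒x≈y (y u) (y v) (p*q≡0⇒q≡0 (κ e) {{pos⇒nonZero (κ e) {{κ>0 e}}}} _ κ[yᵤ-yᵥ]≡0))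
        where
        κ[yᵤ-yᵥ]≡0 : κ e * (y u - y v) ≡ 0ℚ
        κ[yᵤ-yᵥ]≡0 = begin
          κ e * (y u - y v)                ≡⟨ cong (λ w → κ e * (y u - y w)) (Joins⇒opposite Γ uv) ⟨
          κ e * (y u - y (opposite Γ e u)) ≡⟨ flux-incident y (Joins⇒incidentᵇ Γ uv) ⟨
          flux y u e                       ≡⟨ nonneg-sum≡0⇒≡0 (flux y u) (flux-nonneg-at-max y y≤yᵤ) (harmonic u) e ⟩
          0ℚ                               ∎

      max-spreads : ∀ {u w} → (∀ j → y j ≤ y u) → Reach Γ u w → y w ≡ y u
      max-spreads y≤yᵤ here = refl
      max-spreads {u} y≤yᵤ (step {v = v} e uv vw) = trans (max-spreads y≤yᵥ vw) yᵥ≡yᵤ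
        where
        yᵥ≡yᵤ : y v ≡ y u
        yᵥ≡yᵤ = max-spreads-along-edge y≤yᵤ uv
        y≤yᵥ : ∀ j → y j ≤ y v
        y≤yᵥ j = subst (y j ≤_) (sym yᵥ≡yᵤ) (y≤yᵤ j)

harmonic⇒constant : ∀ {k} (Γ : WGraph (suc k)) (κ : Fin (m Γ) → ℚ) → (∀ e → Positive (κ e)) →
                    Connected Γ → ∀ y → Harmonic Γ κ y → ∀ u v → y u ≡ y v
harmonic⇒constant Γ κ κ>0 connected y harmonic u v with M , y≤yₘ ← maximum-point y =
  trans (spread u) (sym (spread v))
  where
  spread : ∀ w → y w ≡ y M
  spread w = max-spreads Γ κ κ>0 harmonic y≤yₘ (connected M w)

-- The Laplacian as an outflow operator

module _ {n} (Γ : WGraph n) where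

  conductance : Fin (m Γ) → ℚ
  conductance e = (1/ fromℕ (ew Γ e)) {{fromℕ-nonZero (ew-pos Γ e)}}

  conductance-pos : ∀ e → Positive (conductance e)
  conductance-pos e = 1/pos⇒pos (fromℕ (ew Γ e)) {{fromℕ-pos (ew-pos Γ e)}}

  potential : (Fin n → ℚ) → Fin n → ℚ
  potential a j = fromℕ (vw Γ j) * a j

  ratio : Fin (m Γ) → Fin n → ℚ
  ratio e j = fromℕ (divEW Γ e (vw Γ j))

  *-ratio : ∀ a e j → ew Γ e ∣ vw Γ j → a j * ratio e j ≡ conductance e * potential a j
  *-ratio a e j ew∣vw = begin
    a j * ratio e j                          ≡⟨ cong (a j *_) (fromℕ-/ (ew-pos Γ e) ew∣vw) ⟩
    a j * (conductance e * fromℕ (vw Γ j))   ≡⟨ solve 3 (λ x κ w → x :* (κ :* w) := κ :* (w :* x)) refl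
                                                  (a j) (conductance e) (fromℕ (vw Γ j)) ⟩
    conductance e * potential a j            ∎

  offDiagonal : Fin n → Fin n → ℚ
  offDiagonal i j = ∑[ e < m Γ ] (if joinsᵇ Γ e i j then ratio e j else 0ℚ)

  offDiagonal-diag : ∀ i → offDiagonal i i ≡ 0ℚ
  offDiagonal-diag i = trans (sum-cong-≗ λ e → cong (λ b → if b then ratio e i else 0ℚ) (joinsᵇ-diag Γ e i))
                             (sum-replicate-zero (m Γ))

  fromℕ-val : ∀ i → fromℕ (val Γ i) ≡ ∑[ e < m Γ ] (if incidentᵇ Γ e i then ratio e i else 0ℚ)
  fromℕ-val i = trans (fromℕ-∑ℕ (λ e → if incidentᵇ Γ e i then divEW Γ e (vw Γ i) else 0))
                      (sum-cong-≗ λ e → if-float fromℕ (incidentᵇ Γ e i))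

  laplacian-entry : ∀ i j →
    toℚ (laplacian Γ i j) ≡ (if does (i ≟ j) then fromℕ (val Γ i) else 0ℚ) - offDiagonal i j
  laplacian-entry i j with i ≟ j
  ... | yes refl = begin
    fromℕ (val Γ i)                        ≡⟨ +-identityʳ _ ⟨
    fromℕ (val Γ i) - 0ℚ                   ≡⟨ cong (λ z → fromℕ (val Γ i) - z) (offDiagonal-diag i) ⟨
    fromℕ (val Γ i) - offDiagonal i i      ∎
  ... | no _ = begin
    toℚ (ℤ.- ℤ.+ ∑ℕ entries)               ≡⟨ toℚ-neg (∑ℕ entries) ⟩
    - fromℕ (∑ℕ entries)                   ≡⟨ cong -_ (fromℕ-∑ℕ entries) ⟩
    - ∑[ e < m Γ ] fromℕ (entries e)       ≡⟨ cong -_ (sum-cong-≗ λ e → if-float fromℕ (joinsᵇ Γ e i j)) ⟩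
    - offDiagonal i j                      ≡⟨ +-identityˡ _ ⟨
    0ℚ - offDiagonal i j                   ∎
    where
    entries : Fin (m Γ) → ℕ
    entries e = if joinsᵇ Γ e i j then divEW Γ e (vw Γ j) else 0

  laplacian-action : ∀ a i →
    ∑[ j < n ] (a j * toℚ (laplacian Γ i j)) ≡ outflow Γ conductance (potential a) i
  laplacian-action a i = begin
    ∑[ j < n ] (a j * toℚ (laplacian Γ i j))
      ≡⟨ sum-cong-≗ (λ j → trans (cong (a j *_) (laplacian-entry i j)) (*-distribˡ-- (a j) _ _)) ⟩
    ∑[ j < n ] (a j * diagonal j - a j * offDiagonal i j)
      ≡⟨ sum-distrib-- (λ j → a j * diagonal j) (λ j → a j * offDiagonal i j) ⟩
    ∑[ j < n ] (a j * diagonal j) - ∑[ j < n ] (a j * offDiagonal i j)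
      ≡⟨ cong₂ _-_ diagonal-part offDiagonal-part ⟩
    ∑[ e < m Γ ] X e - ∑[ e < m Γ ] Y e
      ≡⟨ sum-distrib-- X Y ⟨
    ∑[ e < m Γ ] (X e - Y e)
      ≡⟨ sum-cong-≗ edge-term ⟩
    outflow Γ conductance (potential a) i
      ∎
    where
    diagonal : Fin n → ℚ
    diagonal j = if does (i ≟ j) then fromℕ (val Γ i) else 0ℚ
    g : Fin (m Γ) → Fin n → ℚ
    g e j = a j * ratio e j
    X Y : Fin (m Γ) → ℚ
    X e = if incidentᵇ Γ e i then g e i else 0ℚ
    Y e = if incidentᵇ Γ e i then g e (opposite Γ e i) else 0ℚ

    diagonal-part : ∑[ j < n ] (a j * diagonal j) ≡ sum X
    diagonal-part = begin
      ∑[ j < n ] (a j * diagonal j)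
        ≡⟨ sum-cong-≗ (λ j → *-if (a j) (does (i ≟ j)) _) ⟩
      ∑[ j < n ] (if does (i ≟ j) then a j * fromℕ (val Γ i) else 0ℚ)
        ≡⟨ sum-δ i (λ j → a j * fromℕ (val Γ i)) ⟩
      a i * fromℕ (val Γ i)
        ≡⟨ cong (a i *_) (fromℕ-val i) ⟩
      a i * ∑[ e < m Γ ] (if incidentᵇ Γ e i then ratio e i else 0ℚ)
        ≡⟨ *-distribˡ-sum (a i) (λ e → if incidentᵇ Γ e i then ratio e i else 0ℚ) ⟩
      ∑[ e < m Γ ] (a i * (if incidentᵇ Γ e i then ratio e i else 0ℚ))
        ≡⟨ sum-cong-≗ (λ e → *-if (a i) (incidentᵇ Γ e i) _) ⟩
      sum X
        ∎

    offDiagonal-part : ∑[ j < n ] (a j * offDiagonal i j) ≡ sum Y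
    offDiagonal-part = begin
      ∑[ j < n ] (a j * offDiagonal i j)
        ≡⟨ sum-cong-≗ (λ j → *-distribˡ-sum (a j) (λ e → if joinsᵇ Γ e i j then ratio e j else 0ℚ)) ⟩
      ∑[ j < n ] ∑[ e < m Γ ] (a j * (if joinsᵇ Γ e i j then ratio e j else 0ℚ))
        ≡⟨ sum-cong-≗ (λ j → sum-cong-≗ λ e → *-if (a j) (joinsᵇ Γ e i j) _) ⟩
      ∑[ j < n ] ∑[ e < m Γ ] (if joinsᵇ Γ e i j then g e j else 0ℚ)
        ≡⟨ ∑-comm (λ j e → if joinsᵇ Γ e i j then g e j else 0ℚ) ⟩
      ∑[ e < m Γ ] ∑[ j < n ] (if joinsᵇ Γ e i j then g e j else 0ℚ)
        ≡⟨ sum-cong-≗ (λ e → sum-joinsᵇ Γ e i (g e)) ⟩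
      sum Y
        ∎

    edge-term : ∀ e → X e - Y e ≡ flux Γ conductance (potential a) i e
    edge-term e with incidentᵇ Γ e i in inc
    ... | true  = trans (cong₂ _-_ (*-ratio a e i (ew∣incident Γ e i inc))
                                   (*-ratio a e (opposite Γ e i) (ew∣opposite Γ e i)))
                        (sym (*-distribˡ-- (conductance e) _ _))
    ... | false = refl


laplacian-indep-columns : ∀ {k} (Γ : WGraph (suc k)) → Connected Γ → HasIndepColumns (laplacian Γ) k
laplacian-indep-columns {k} Γ connected = suc , suc-injective , independent
  where
  independent : ColumnsIndependent (laplacian Γ) suc
  independent a a∈ker t =
    p*q≡0⇒q≡0 (fromℕ (vw Γ (suc t))) {{fromℕ-nonZero (vw-pos Γ (suc t))}} (a t) (begin
      potential Γ a₀ (suc t)  ≡⟨ harmonic⇒constant Γ (conductance Γ) (conductance-pos Γ) connected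
                                   (potential Γ a₀) harmonic (suc t) zero ⟩
      potential Γ a₀ zero     ≡⟨ *-zeroʳ (fromℕ (vw Γ zero)) ⟩
      0ℚ                      ∎)
    where
    a₀ : Fin (suc k) → ℚ
    a₀ = 0ℚ ∷ a
    column-sum : Fin (suc k) → ℚ
    column-sum i = ∑[ t < k ] (a t * toℚ (laplacian Γ i (suc t)))
    harmonic : Harmonic Γ (conductance Γ) (potential Γ a₀)
    harmonic i = begin
      outflow Γ (conductance Γ) (potential Γ a₀) i     ≡⟨ laplacian-action Γ a₀ i ⟨
      0ℚ * toℚ (laplacian Γ i zero) + column-sum i     ≡⟨ cong (_+ column-sum i) (*-zeroˡ (toℚ (laplacian Γ i zero))) ⟩
      0ℚ + column-sum i                                ≡⟨ +-identityˡ (column-sum i) ⟩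
      column-sum i                                     ≡⟨ ∑ℚ≡sum (λ t → a t * toℚ (laplacian Γ i (suc t))) ⟨
      ∑ℚ (λ t → a t * toℚ (laplacian Γ i (suc t)))     ≡⟨ a∈ker i ⟩
      0ℚ                                               ∎

-- The vector 1/w(v) is a nonzero kernel vector: its potential is constant.
laplacian-not-full-rank : ∀ {n} (Γ : WGraph (suc n)) → ¬ HasIndepColumns (laplacian Γ) (suc n)
laplacian-not-full-rank {n} Γ (σ , σ-inj , independent) = 1≢0 (begin
  1ℚ                          ≡⟨ potential-b (σ zero) ⟨
  potential Γ b (σ zero)      ≡⟨ cong (fromℕ (vw Γ (σ zero)) *_) (independent (λ t → b (σ t)) b∘σ∈ker zero) ⟩
  fromℕ (vw Γ (σ zero)) * 0ℚ  ≡⟨ *-zeroʳ (fromℕ (vw Γ (σ zero))) ⟩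
  0ℚ                          ∎)
  where
  b : Fin (suc n) → ℚ
  b j = (1/ fromℕ (vw Γ j)) {{fromℕ-nonZero (vw-pos Γ j)}}
  potential-b : ∀ j → potential Γ b j ≡ 1ℚ
  potential-b j = *-inverseʳ (fromℕ (vw Γ j)) {{fromℕ-nonZero (vw-pos Γ j)}}
  b∘σ∈ker : ∀ i → ∑ℚ (λ t → b (σ t) * toℚ (laplacian Γ i (σ t))) ≡ 0ℚ
  b∘σ∈ker i = begin
    ∑ℚ (λ t → b (σ t) * toℚ (laplacian Γ i (σ t)))
      ≡⟨ ∑ℚ≡sum (λ t → b (σ t) * toℚ (laplacian Γ i (σ t))) ⟩
    ∑[ t < suc n ] (b (σ t) * toℚ (laplacian Γ i (σ t)))
      ≡⟨ sum-reindex σ-inj (λ j → b j * toℚ (laplacian Γ i j)) ⟩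
    ∑[ j < suc n ] (b j * toℚ (laplacian Γ i j))       ≡⟨ laplacian-action Γ b i ⟩
    outflow Γ (conductance Γ) (potential Γ b) i        ≡⟨ constant⇒harmonic Γ (conductance Γ) _ 1ℚ potential-b i ⟩
    0ℚ                                                 ∎

mainTheorem3 : ∀ (k : ℕ) (Γ : WGraph (suc k)) → Connected Γ → HasRank (laplacian Γ) k
mainTheorem3 k Γ connected = laplacian-indep-columns Γ connected , no-more-columns
  where
  no-more-columns : ∀ k′ → k ℕ.< k′ → ¬ HasIndepColumns (laplacian Γ) k′
  no-more-columns k′ k<k′ cols@(σ , σ-inj , _) with ℕ.≤-antisym (injective⇒≤ σ-inj) k<k′
  ... | refl = laplacian-not-full-rank Γ cols
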